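{- Let $d\geq2$ and $n\geq3$. Let $p$ be a prime and $r\geq1$. Then $$\frac{1}{\#\mathfrak{R}_{N_{d,n}}(p^r)}\sum_{\mathbf{a}\in\mathfrak{R}_{N_{d,n}}(p^r)}\sigma(\mathbf{a};p^r)=1+O\left(\frac{1}{p^{n+1}}\right),$$ where the implied constant depends at most on $d$ and $n$.
   Context: $N_{d,n}=\binom{n+d}{d}$ and $\nu_{d,n}$ maps $(x_0,\dots,x_n)$ (over $\mathbb{Z}/Q\mathbb{Z}$) to the list of all degree $d$ monomials (coefficient $1$) in lexicographic order. For $Q,N\geq1$, $\mathfrak{R}_N(Q)=\{\mathbf{b}\in(\mathbb{Z}/Q\mathbb{Z})^N:\gcd(Q,b_1,\dots,b_N)=1\}$. For $\mathbf{a}\in(\mathbb{Z}/Q\mathbb{Z})^{N_{d,n}}$, $\sigma(\mathbf{a};Q)=Q^{ -n}\#\{\mathbf{b}\in\mathfrak{R}_{n+1}(Q):\langle\mathbf{a},\nu_{d,n}(\mathbf{b})\rangle\equiv0\bmod Q\}$. -}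

module Defs where

open import Data.Nat using (ℕ; zero; suc; _+_; _*_; _∸_; _^_)
open import Data.Nat.GCD using (gcd)
open import Data.Nat.Divisibility using (_∣?_)
open import Data.Nat.Combinatorics using (_C_)
open import Data.Fin using (Fin; toℕ)
open import Data.Vec using (Vec; []; _∷_; toList)
open import Data.List using (List; []; _∷_; [_]; map; concatMap; upTo; reverse; allFin; filter; length; foldr; zipWith)
open import Data.Nat.ListAction using (sum)
open import Data.Integer using (+_)
import Data.Rational as ℚ
open import Data.Rational using (ℚ; 0ℚ)
open import Relation.Nullary.Decidable using (Dec)
import Data.Nat as ℕ

Ndn : ℕ → ℕ → ℕ
Ndn d n = (n + d) C d

-- Elements of (Z/QZ) are represented by Fin Q; (Z/QZ)^N by Vec (Fin Q) N.
-- All vectors in (Z/QZ)^N.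
allVecs : (N Q : ℕ) → List (Vec (Fin Q) N)
allVecs zero Q = [ [] ]
allVecs (suc N) Q = concatMap (λ x → map (x ∷_) (allVecs N Q)) (allFin Q)

gcdAll : ∀ {N Q} → ℕ → Vec (Fin Q) N → ℕ
gcdAll g [] = g
gcdAll g (b ∷ bs) = gcdAll (gcd g (toℕ b)) bs

primVecs : (N Q : ℕ) → List (Vec (Fin Q) N)
primVecs N Q = filter (λ b → gcdAll Q b ℕ.≟ 1) (allVecs N Q)

-- exponent vectors of length k with total degree d, in lexicographic
-- order of the corresponding monomials (x_0^d first)
exps : (k d : ℕ) → List (Vec ℕ k)
exps zero zero = [ [] ]
exps zero (suc d) = []
exps (suc k) d = concatMap (λ e → map (e ∷_) (exps k (d ∸ e))) (reverse (upTo (suc d)))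

monomial : ∀ {k Q} → Vec (Fin Q) k → Vec ℕ k → ℕ
monomial [] [] = 1
monomial (b ∷ bs) (e ∷ es) = (toℕ b ^ e) * monomial bs es

-- ν_{d,n}(b): list of all degree-d monomials in b_0..b_n (lex order),
-- as natural-number representatives (reduction mod Q happens in the test below)
ν : ∀ {Q} (d n : ℕ) → Vec (Fin Q) (suc n) → List ℕ
ν d n b = map (monomial b) (exps (suc n) d)

pairing : ∀ {Q} (d n : ℕ) → Vec (Fin Q) (Ndn d n) → Vec (Fin Q) (suc n) → ℕ
pairing d n a b = sum (zipWith _*_ (map toℕ (toList a)) (ν d n b))

-- division of naturals into ℚ (convention: m ÷ 0 = 0; never used with 0 here)
_÷ℕ_ : ℕ → ℕ → ℚ
m ÷ℕ zero = 0ℚ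
m ÷ℕ suc k = (+ m) ℚ./ suc k

σ : ∀ {Q} (d n : ℕ) → Vec (Fin Q) (Ndn d n) → ℚ
σ {Q} d n a = length (filter (λ b → Q ∣? pairing d n a b) (primVecs (suc n) Q)) ÷ℕ (Q ^ n)

sumℚ : List ℚ → ℚ
sumℚ = foldr ℚ._+_ 0ℚ

avgσ : (d n Q : ℕ) → ℚ
avgσ d n Q = sumℚ (map (σ d n) (primVecs (Ndn d n) Q)) ℚ.* (1 ÷ℕ length (primVecs (Ndn d n) Q))

{-# OPTIONS --safe #-}
-- Write Q = p^(r+1) = p s. A vector over ℤ/Q is primitive exactly when p does not divide
-- all of its entries, so #ℜ_k(Q) = Q^k − s^k = s^k (p^k − 1). For primitive b one of the
-- monomials of ν(b) is a pure power of an entry prime to p, hence a unit mod Q; solving the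
-- congruence ⟨a, ν(b)⟩ ≡ 0 for that coordinate shows that exactly s^(N−1) (p^(N−1) − 1)
-- primitive a satisfy it, whatever b is (N = N_{d,n}). Exchanging the two summations gives
--   avg σ = (p^(N−1) − 1)(p^(n+1) − 1) / (p^n (p^N − 1)),
-- and since N − 1 ≥ n + 1 for d ≥ 2, its distance to 1 is at most 4 / p^(n+1).
module Submission where

open import Defs
open import Data.Nat using (ℕ; zero; suc; _≤_; _^_; s≤s; z≤n)
open import Data.Nat.Primality using (Prime)
open import Data.Nat.Properties using (≤-trans)
open import Data.Product using (∃-syntax; _,_)

module AverageOverPrimePowers where

  open import Level using (Level)
  open import Data.Bool using (true; false; if_then_else_)
  open import Data.Empty using (⊥-elim)
  open import Data.Fin using (Fin; toℕ)
  import Data.Fin as Fin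
  open import Data.List using (List; []; _∷_; map; filter; length; concatMap; reverse; upTo; applyUpTo; allFin; tabulate; zipWith; _++_)
  open import Data.List.Properties using (length-map; map-++; map-∘; map-tabulate; reverse-map)
  open import Data.List.Relation.Binary.Permutation.Propositional.Properties using (↭-reverse)
  open import Data.List.Relation.Unary.Any using (Any; here; there)
  import Data.List.Relation.Unary.Any as Any
  open import Data.List.Relation.Unary.Any.Properties using (map⁺; concat⁺; applyUpTo⁺; reverse⁺)
  open import Data.Nat
  open import Data.Nat.Properties
  open import Data.Nat.Combinatorics using (_C_; nCn≡1; nC1≡n; nCk+nC[k+1]≡[n+1]C[k+1])
  open import Data.Nat.Coprimality using (Coprime; coprime-Bézout; coprime-divisor)
  import Data.Nat.Coprimality as Coprime
  open import Data.Nat.Divisibility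
  open import Data.Nat.DivMod using (m≡m%n+[m/n]*n; m%n<n)
  open import Data.Nat.GCD using (module Bézout; gcd; gcd[m,n]∣m; gcd[m,n]∣n; gcd-greatest)
  open import Data.Nat.ListAction using (sum)
  open import Data.Nat.ListAction.Properties using (sum-++; sum-↭)
  open import Data.Nat.Primality using (Prime; prime⇒irreducible; prime⇒nonTrivial; prime⇒nonZero; euclidsLemma)
  open import Data.Nat.Tactic.RingSolver using (solve-∀)
  import Data.Integer as ℤ
  open import Data.Integer.GCD using () renaming (gcd to ℤ-gcd)
  import Data.Integer.Properties as ℤP
  open import Data.Integer.Tactic.RingSolver using () renaming (solve-∀ to ℤ-solve-∀)
  import Data.Rational as ℚ
  import Data.Rational.Properties as ℚP
  import Data.Rational.Unnormalised as ℚᵘ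
  import Data.Rational.Unnormalised.Properties as ℚᵘP
  open import Data.Product using (_×_; _,_; proj₁; proj₂; ∃-syntax)
  open import Data.Sum using (_⊎_; inj₁; inj₂)
  open import Data.Vec using (Vec; []; _∷_; toList)
  open import Function using (_∘_; id)
  open import Relation.Nullary using (¬_; Dec; does; yes; no)
  open import Relation.Unary using (Pred; Decidable)
  open import Relation.Binary.PropositionalEquality
  open import Algebra.Properties.CommutativeSemigroup +-commutativeSemigroup
    using (interchange) renaming (xy∙z≈xz∙y to +-right-comm)
  open import Algebra.Properties.CommutativeSemigroup *-commutativeSemigroup
    using () renaming (x∙yz≈y∙xz to *-left-comm)

  private variable
    ℓ ℓ′ ℓ″ : Level
    A B : Set ℓ

  𝟙 : {P : Set ℓ} → Dec P → ℕ
  𝟙 d = if does d then 1 else 0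

  𝟙-yes : {P : Set ℓ} (d : Dec P) → P → 𝟙 d ≡ 1
  𝟙-yes (yes _) _ = refl
  𝟙-yes (no ¬p) p = ⊥-elim (¬p p)

  𝟙-no : {P : Set ℓ} (d : Dec P) → ¬ P → 𝟙 d ≡ 0
  𝟙-no (yes p) ¬p = ⊥-elim (¬p p)
  𝟙-no (no _) _ = refl

  𝟙-⇔ : {P : Set ℓ} {R : Set ℓ′} (d : Dec P) (e : Dec R) → (P → R) → (R → P) → 𝟙 d ≡ 𝟙 e
  𝟙-⇔ (yes p) e to _ = sym (𝟙-yes e (to p))
  𝟙-⇔ (no ¬p) e _ from = sym (𝟙-no e (¬p ∘ from))

  𝟙-× : {P : Set ℓ} {R : Set ℓ′} {S : Set ℓ″} (d : Dec P) (e : Dec R) (f : Dec S) →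
        (S → P × R) → (P → R → S) → 𝟙 f ≡ 𝟙 d * 𝟙 e
  𝟙-× (yes p) (yes r) f _ pair = 𝟙-yes f (pair p r)
  𝟙-× (yes _) (no ¬r) f split _ = 𝟙-no f (¬r ∘ proj₂ ∘ split)
  𝟙-× (no ¬p) e f split _ = 𝟙-no f (¬p ∘ proj₁ ∘ split)

  ⟦_∣_⟧ : ℕ → ℕ → ℕ
  ⟦ g ∣ x ⟧ = 𝟙 (g ∣? x)

  ⟦∣⟧-+ : ∀ {g t} c → g ∣ t → ⟦ g ∣ c + t ⟧ ≡ ⟦ g ∣ c ⟧
  ⟦∣⟧-+ {g} {t} c g∣t = 𝟙-⇔ (g ∣? c + t) (g ∣? c)
    (λ g∣c+t → ∣m+n∣m⇒∣n (subst (g ∣_) (+-comm c t) g∣c+t) g∣t) (λ g∣c → ∣m∣n⇒∣m+n g∣c g∣t)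

  *⟦∣⟧-+ : ∀ {i g t} c → i ≡ 0 ⊎ g ∣ t → i * ⟦ g ∣ c + t ⟧ ≡ i * ⟦ g ∣ c ⟧
  *⟦∣⟧-+ c (inj₁ refl) = refl
  *⟦∣⟧-+ {i} c (inj₂ g∣t) = cong (i *_) (⟦∣⟧-+ c g∣t)

  ⟦∣⟧≡0⊎∣* : ∀ g x w → ⟦ g ∣ x ⟧ ≡ 0 ⊎ g ∣ x * w
  ⟦∣⟧≡0⊎∣* g x w with g ∣? x
  ... | no _ = inj₁ refl
  ... | yes g∣x = inj₂ (∣m⇒∣m*n w g∣x)

  ∑ : List A → (A → ℕ) → ℕ
  ∑ xs f = sum (map f xs)

  ∑< : ℕ → (ℕ → ℕ) → ℕ
  ∑< zero f = 0
  ∑< (suc n) f = f 0 + ∑< n (f ∘ suc)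

  infix 5 ∑ ∑<
  syntax ∑ xs (λ x → e) = ∑[ x ∈ xs ] e
  syntax ∑< n (λ x → e) = ∑[ x < n ] e

  ∑-cong : ∀ (xs : List A) {f g : A → ℕ} → (∀ x → f x ≡ g x) → ∑ xs f ≡ ∑ xs g
  ∑-cong [] _ = refl
  ∑-cong (x ∷ xs) f≗g = cong₂ _+_ (f≗g x) (∑-cong xs f≗g)

  ∑-zero : ∀ (xs : List A) → ∑[ x ∈ xs ] 0 ≡ 0
  ∑-zero [] = refl
  ∑-zero (x ∷ xs) = ∑-zero xs

  ∑-+ : ∀ (xs : List A) (f g : A → ℕ) → ∑[ x ∈ xs ] (f x + g x) ≡ ∑ xs f + ∑ xs g
  ∑-+ [] f g = refl
  ∑-+ (x ∷ xs) f g = trans (cong (f x + g x +_) (∑-+ xs f g)) (interchange (f x) (g x) _ _)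

  ∑-*ˡ : ∀ (xs : List A) k (f : A → ℕ) → ∑[ x ∈ xs ] k * f x ≡ k * ∑ xs f
  ∑-*ˡ [] k f = sym (*-zeroʳ k)
  ∑-*ˡ (x ∷ xs) k f = trans (cong (k * f x +_) (∑-*ˡ xs k f)) (sym (*-distribˡ-+ k (f x) _))

  ∑-*ʳ : ∀ (xs : List A) k (f : A → ℕ) → ∑[ x ∈ xs ] f x * k ≡ ∑ xs f * k
  ∑-*ʳ xs k f = trans (∑-cong xs (λ x → *-comm (f x) k)) (trans (∑-*ˡ xs k f) (*-comm k _))

  ∑-++ : ∀ (xs ys : List A) (f : A → ℕ) → ∑ (xs ++ ys) f ≡ ∑ xs f + ∑ ys f
  ∑-++ xs ys f = trans (cong sum (map-++ f xs ys)) (sum-++ (map f xs) (map f ys))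

  ∑-map : ∀ (xs : List A) (h : A → B) (f : B → ℕ) → ∑ (map h xs) f ≡ ∑[ x ∈ xs ] f (h x)
  ∑-map xs h f = cong sum (sym (map-∘ xs))

  ∑-concatMap : ∀ (xs : List A) (ys : A → List B) (f : B → ℕ) →
                ∑ (concatMap ys xs) f ≡ ∑[ x ∈ xs ] ∑ (ys x) f
  ∑-concatMap [] ys f = refl
  ∑-concatMap (x ∷ xs) ys f = trans (∑-++ (ys x) (concatMap ys xs) f) (cong (∑ (ys x) f +_) (∑-concatMap xs ys f))

  ∑-reverse : ∀ (xs : List A) (f : A → ℕ) → ∑ (reverse xs) f ≡ ∑ xs f
  ∑-reverse xs f = trans (cong sum (reverse-map f xs)) (sum-↭ (↭-reverse (map f xs)))

  ∑-swap : ∀ (xs : List A) (ys : List B) (f : A → B → ℕ) →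
           ∑[ x ∈ xs ] ∑[ y ∈ ys ] f x y ≡ ∑[ y ∈ ys ] ∑[ x ∈ xs ] f x y
  ∑-swap [] ys f = sym (∑-zero ys)
  ∑-swap (x ∷ xs) ys f = trans (cong (∑ ys (f x) +_) (∑-swap xs ys f)) (sym (∑-+ ys (f x) _))

  ∑-filter : ∀ {p} {P : Pred A p} (P? : Decidable P) xs (f : A → ℕ) →
             ∑ (filter P? xs) f ≡ ∑[ x ∈ xs ] 𝟙 (P? x) * f x
  ∑-filter P? [] f = refl
  ∑-filter P? (x ∷ xs) f with does (P? x)
  ... | true = cong₂ _+_ (sym (+-identityʳ (f x))) (∑-filter P? xs f)
  ... | false = ∑-filter P? xs f

  length≡∑1 : ∀ (xs : List A) → length xs ≡ ∑[ x ∈ xs ] 1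
  length≡∑1 [] = refl
  length≡∑1 (x ∷ xs) = cong suc (length≡∑1 xs)

  length-filter : ∀ {p} {P : Pred A p} (P? : Decidable P) xs → length (filter P? xs) ≡ ∑[ x ∈ xs ] 𝟙 (P? x)
  length-filter P? xs = trans (length≡∑1 (filter P? xs)) (trans (∑-filter P? xs (λ _ → 1)) (∑-cong xs (λ x → *-identityʳ _)))

  length-concatMap : ∀ (xs : List A) (ys : A → List B) → length (concatMap ys xs) ≡ ∑[ x ∈ xs ] length (ys x)
  length-concatMap xs ys = trans (length≡∑1 (concatMap ys xs))
    (trans (∑-concatMap xs ys (λ _ → 1)) (∑-cong xs (λ x → sym (length≡∑1 (ys x)))))

  ∑-filter-cong : ∀ {p} {P : Pred A p} (P? : Decidable P) xs {f g : A → ℕ} →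
                  (∀ x → P x → f x ≡ g x) → ∑ (filter P? xs) f ≡ ∑ (filter P? xs) g
  ∑-filter-cong P? [] _ = refl
  ∑-filter-cong P? (x ∷ xs) f≗g with P? x
  ... | yes px = cong₂ _+_ (f≗g x px) (∑-filter-cong P? xs f≗g)
  ... | no _ = ∑-filter-cong P? xs f≗g

  ∑-const : ∀ (xs : List A) k → ∑[ x ∈ xs ] k ≡ k * length xs
  ∑-const [] k = sym (*-zeroʳ k)
  ∑-const (x ∷ xs) k = trans (cong (k +_) (∑-const xs k)) (sym (*-suc k (length xs)))

  ∑-allFin : ∀ n (f : ℕ → ℕ) → ∑[ i ∈ allFin n ] f (toℕ i) ≡ ∑< n f
  ∑-allFin zero f = refl
  ∑-allFin (suc n) f = cong (f 0 +_) (begin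
    ∑[ i ∈ tabulate {n = n} Fin.suc ] f (toℕ i)   ≡⟨ cong (λ is → ∑[ i ∈ is ] f (toℕ i)) (map-tabulate {n = n} id Fin.suc) ⟨
    ∑[ i ∈ map Fin.suc (allFin n) ] f (toℕ i)       ≡⟨ ∑-map (allFin n) Fin.suc (f ∘ toℕ) ⟩
    ∑[ i ∈ allFin n ] f (suc (toℕ i))               ≡⟨ ∑-allFin n (f ∘ suc) ⟩
    ∑< n (f ∘ suc)                                   ∎)
    where open ≡-Reasoning

  ∑<-cong : ∀ n {f g : ℕ → ℕ} → (∀ x → f x ≡ g x) → ∑< n f ≡ ∑< n g
  ∑<-cong zero _ = refl
  ∑<-cong (suc n) f≗g = cong₂ _+_ (f≗g 0) (∑<-cong n (f≗g ∘ suc))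

  ∑<-+ : ∀ m n (f : ℕ → ℕ) → ∑< (m + n) f ≡ ∑< m f + (∑[ x < n ] f (m + x))
  ∑<-+ zero n f = refl
  ∑<-+ (suc m) n f = trans (cong (f 0 +_) (∑<-+ m n (f ∘ suc))) (sym (+-assoc (f 0) _ _))

  ∑<-suc : ∀ n (f : ℕ → ℕ) → ∑< (suc n) f ≡ ∑< n f + f n
  ∑<-suc n f = begin
    ∑< (suc n) f               ≡⟨ cong (λ m → ∑< m f) (+-comm 1 n) ⟩
    ∑< (n + 1) f               ≡⟨ ∑<-+ n 1 f ⟩
    ∑< n f + (f (n + 0) + 0)   ≡⟨ cong (∑< n f +_) (trans (+-identityʳ _) (cong f (+-identityʳ n))) ⟩
    ∑< n f + f n               ∎
    where open ≡-Reasoning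

  ∑<-zero : ∀ n (f : ℕ → ℕ) → (∀ x → x < n → f x ≡ 0) → ∑< n f ≡ 0
  ∑<-zero zero f _ = refl
  ∑<-zero (suc n) f f≡0 = cong₂ _+_ (f≡0 0 z<s) (∑<-zero n (f ∘ suc) (λ x x<n → f≡0 (suc x) (s<s x<n)))

  ∑<-point : ∀ n (f : ℕ → ℕ) {x₀} → x₀ < n → (∀ x → x < n → x ≢ x₀ → f x ≡ 0) → ∑< n f ≡ f x₀
  ∑<-point (suc n) f {zero} _ f≡0 =
    trans (cong (f 0 +_) (∑<-zero n (f ∘ suc) (λ x x<n → f≡0 (suc x) (s<s x<n) (λ ())))) (+-identityʳ (f 0))
  ∑<-point (suc n) f {suc x₀} (s<s x₀<n) f≡0 =
    cong₂ _+_ (f≡0 0 z<s (λ ())) (∑<-point n (f ∘ suc) x₀<n (λ x x<n x≢x₀ → f≡0 (suc x) (s<s x<n) (x≢x₀ ∘ suc-injective)))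

  ∑<-reverse : ∀ d (f : ℕ → ℕ) → ∑[ e < suc d ] f (d ∸ e) ≡ ∑< (suc d) f
  ∑<-reverse zero f = refl
  ∑<-reverse (suc d) f = begin
    f (suc d) + (∑[ e < suc d ] f (d ∸ e)) ≡⟨ cong (f (suc d) +_) (∑<-reverse d f) ⟩
    f (suc d) + ∑< (suc d) f               ≡⟨ +-comm (f (suc d)) _ ⟩
    ∑< (suc d) f + f (suc d)               ≡⟨ ∑<-suc (suc d) f ⟨
    ∑< (suc (suc d)) f                     ∎
    where open ≡-Reasoning

  ∑-applyUpTo : ∀ (g : ℕ → ℕ) n (f : ℕ → ℕ) → ∑ (applyUpTo g n) f ≡ ∑[ x < n ] f (g x)
  ∑-applyUpTo g zero f = refl
  ∑-applyUpTo g (suc n) f = cong (f (g 0) +_) (∑-applyUpTo (g ∘ suc) n f)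

  ⟦_∣*_⟧ : ∀ {Q k} → ℕ → Vec (Fin Q) k → ℕ
  ⟦ g ∣* [] ⟧ = 1
  ⟦ g ∣* x ∷ a ⟧ = ⟦ g ∣ toℕ x ⟧ * ⟦ g ∣* a ⟧

  ⟦1∣*⟧≡1 : ∀ {Q k} (a : Vec (Fin Q) k) → ⟦ 1 ∣* a ⟧ ≡ 1
  ⟦1∣*⟧≡1 [] = refl
  ⟦1∣*⟧≡1 (x ∷ a) = cong₂ _*_ (𝟙-yes (1 ∣? toℕ x) (1∣ toℕ x)) (⟦1∣*⟧≡1 a)

  dot : ∀ {Q k} → Vec (Fin Q) k → List ℕ → ℕ
  dot a v = sum (zipWith _*_ (map toℕ (toList a)) v)

  ⟦∣*⟧≡0⊎∣dot : ∀ {Q k} g (a : Vec (Fin Q) k) v → ⟦ g ∣* a ⟧ ≡ 0 ⊎ g ∣ dot a v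
  ⟦∣*⟧≡0⊎∣dot g [] v = inj₂ (g ∣0)
  ⟦∣*⟧≡0⊎∣dot g (x ∷ a) [] = inj₂ (g ∣0)
  ⟦∣*⟧≡0⊎∣dot g (x ∷ a) (w ∷ v) with g ∣? toℕ x | ⟦∣*⟧≡0⊎∣dot g a v
  ... | no _ | _ = inj₁ refl
  ... | yes _ | inj₁ a≡0 = inj₁ (trans (+-identityʳ _) a≡0)
  ... | yes g∣x | inj₂ g∣dot = inj₂ (∣m∣n⇒∣m+n (∣m⇒∣m*n w g∣x) g∣dot)

  ∑-allVecs : ∀ k Q (F : Vec (Fin Q) (suc k) → ℕ) →
              ∑ (allVecs (suc k) Q) F ≡ ∑[ x ∈ allFin Q ] ∑[ a ∈ allVecs k Q ] F (x ∷ a)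
  ∑-allVecs k Q F = trans (∑-concatMap (allFin Q) (λ x → map (x ∷_) (allVecs k Q)) F)
                          (∑-cong (allFin Q) (λ x → ∑-map (allVecs k Q) (x ∷_) F))

  prime∤1 : ∀ {p} → Prime p → ¬ p ∣ 1
  prime∤1 p-prime p∣1 = nonTrivial⇒≢1 {{prime⇒nonTrivial p-prime}} (∣1⇒≡1 p∣1)

  ∤⇒coprime : ∀ {p d} → Prime p → ¬ p ∣ d → Coprime d p
  ∤⇒coprime p-prime p∤d (e∣d , e∣p) with prime⇒irreducible p-prime e∣p
  ... | inj₁ e≡1 = e≡1
  ... | inj₂ refl = ⊥-elim (p∤d e∣d)

  ∣^∧∤⇒≡1 : ∀ {p d} → Prime p → ∀ r → d ∣ p ^ r → ¬ p ∣ d → d ≡ 1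
  ∣^∧∤⇒≡1 _ zero d∣1 _ = ∣1⇒≡1 d∣1
  ∣^∧∤⇒≡1 p-prime (suc r) d∣p^r p∤d = ∣^∧∤⇒≡1 p-prime r (coprime-divisor (∤⇒coprime p-prime p∤d) d∣p^r) p∤d

  ∤⇒coprime-^ : ∀ {p w} → Prime p → ∀ r → ¬ p ∣ w → Coprime w (p ^ r)
  ∤⇒coprime-^ p-prime r p∤w (e∣w , e∣p^r) = ∣^∧∤⇒≡1 p-prime r e∣p^r (λ p∣e → p∤w (∣-trans p∣e e∣w))

  ∤⇒∤^ : ∀ {p x} → Prime p → ¬ p ∣ x → ∀ d → ¬ p ∣ x ^ d
  ∤⇒∤^ p-prime _ zero = prime∤1 p-prime
  ∤⇒∤^ {x = x} p-prime p∤x (suc d) p∣x^d+1 with euclidsLemma x (x ^ d) p-prime p∣x^d+1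
  ... | inj₁ p∣x = p∤x p∣x
  ... | inj₂ p∣x^d = ∤⇒∤^ p-prime p∤x d p∣x^d

  <∧∣⇒≡0 : ∀ {Q t} → t < Q → Q ∣ t → t ≡ 0
  <∧∣⇒≡0 {t = zero} _ _ = refl
  <∧∣⇒≡0 {t = suc t} t<Q Q∣t = ⊥-elim (>⇒∤ t<Q Q∣t)

  ∑<-multiples : ∀ h g .{{_ : NonZero g}} → ∑[ x < h * g ] ⟦ g ∣ x ⟧ ≡ h
  ∑<-multiples zero g = refl
  ∑<-multiples (suc h) g = begin
    ∑[ x < g + h * g ] ⟦ g ∣ x ⟧                         ≡⟨ ∑<-+ g (h * g) (λ x → ⟦ g ∣ x ⟧) ⟩
    (∑[ x < g ] ⟦ g ∣ x ⟧) + (∑[ x < h * g ] ⟦ g ∣ g + x ⟧) ≡⟨ cong₂ _+_ first-block (∑<-cong (h * g) shift) ⟩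
    1 + (∑[ x < h * g ] ⟦ g ∣ x ⟧)                       ≡⟨ cong suc (∑<-multiples h g) ⟩
    suc h                                               ∎
    where
    open ≡-Reasoning
    shift : ∀ x → ⟦ g ∣ g + x ⟧ ≡ ⟦ g ∣ x ⟧
    shift x = trans (cong (λ y → ⟦ g ∣ y ⟧) (+-comm g x)) (⟦∣⟧-+ x (∣-refl {g}))
    first-block : ∑[ x < g ] ⟦ g ∣ x ⟧ ≡ 1
    first-block = trans (∑<-point g (λ x → ⟦ g ∣ x ⟧) (>-nonZero⁻¹ g) (λ x x<g x≢0 → 𝟙-no (g ∣? x) (x≢0 ∘ <∧∣⇒≡0 x<g)))
                        (𝟙-yes (g ∣? 0) (g ∣0))

  private
    -- x w ≡ ±1 (mod q + 1); in the first case q ≡ -1 supplies the sign.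
    bézout-solution : ∀ {q w} c → Bézout.Identity 1 w (suc q) → ∃[ z ] suc q ∣ c + z * w
    bézout-solution {q} {w} c (Bézout.+- x y 1+yQ≡xw) = c * q * x , divides (c + c * q * y) (begin
      c + c * q * x * w            ≡⟨ cong (c +_) (*-assoc (c * q) x w) ⟩
      c + c * q * (x * w)          ≡⟨ cong (λ t → c + c * q * t) 1+yQ≡xw ⟨
      c + c * q * (1 + y * suc q)  ≡⟨ rearrange c q y ⟩
      (c + c * q * y) * suc q      ∎)
      where
      open ≡-Reasoning
      rearrange : ∀ c q y → c + c * q * (1 + y * suc q) ≡ (c + c * q * y) * suc q
      rearrange = solve-∀
    bézout-solution {q} {w} c (Bézout.-+ x y 1+xw≡yQ) = c * x , divides (c * y) (begin
      c + c * x * w    ≡⟨ rearrange c x w ⟩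
      c * (1 + x * w)  ≡⟨ cong (c *_) 1+xw≡yQ ⟩
      c * (y * suc q)  ≡⟨ *-assoc c y (suc q) ⟨
      c * y * suc q    ∎)
      where
      open ≡-Reasoning
      rearrange : ∀ c x w → c + c * x * w ≡ c * (1 + x * w)
      rearrange = solve-∀

  congruence-solvable : ∀ {Q} .{{_ : NonZero Q}} {w} c → Coprime w Q → ∃[ x ] x < Q × Q ∣ c + x * w
  congruence-solvable {suc q} {w} c cop with z , Q∣c+zw ← bézout-solution c (coprime-Bézout cop) =
    z % suc q , m%n<n z (suc q) , ∣m+n∣m⇒∣n (subst (suc q ∣_) split Q∣c+zw) (n∣m*n (z / suc q * w))
    where
    rearrange : ∀ c r k Q w → c + (r + k * Q) * w ≡ k * w * Q + (c + r * w)
    rearrange = solve-∀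
    split : c + z * w ≡ z / suc q * w * suc q + (c + z % suc q * w)
    split = trans (cong (λ t → c + t * w) (m≡m%n+[m/n]*n z (suc q))) (rearrange c (z % suc q) (z / suc q) (suc q) w)

  private
    congruence-unique-≤ : ∀ {Q w c x y} → Coprime w Q → y < Q → x ≤ y → Q ∣ c + x * w → Q ∣ c + y * w → x ≡ y
    congruence-unique-≤ {Q} {w} {c} {x} {y} cop y<Q x≤y Q∣c+xw Q∣c+yw = begin
      x            ≡⟨ +-identityʳ x ⟨
      x + 0        ≡⟨ cong (x +_) y∸x≡0 ⟨
      x + (y ∸ x)  ≡⟨ m+[n∸m]≡n x≤y ⟩
      y            ∎
      where
      open ≡-Reasoning
      rearrange : ∀ c x t w → c + (x + t) * w ≡ (c + x * w) + t * w
      rearrange = solve-∀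
      Q∣[y∸x]w : Q ∣ (y ∸ x) * w
      Q∣[y∸x]w = ∣m+n∣m⇒∣n (subst (Q ∣_) (rearrange c x (y ∸ x) w)
                   (subst (λ t → Q ∣ c + t * w) (sym (m+[n∸m]≡n x≤y)) Q∣c+yw)) Q∣c+xw
      y∸x≡0 : y ∸ x ≡ 0
      y∸x≡0 = <∧∣⇒≡0 (≤-<-trans (m∸n≤m y x) y<Q)
                (coprime-divisor (Coprime.sym cop) (subst (Q ∣_) (*-comm (y ∸ x) w) Q∣[y∸x]w))

  congruence-unique : ∀ {Q w c x y} → Coprime w Q → x < Q → y < Q → Q ∣ c + x * w → Q ∣ c + y * w → x ≡ y
  congruence-unique {x = x} {y} cop x<Q y<Q Q∣c+xw Q∣c+yw with ≤-total x y
  ... | inj₁ x≤y = congruence-unique-≤ cop y<Q x≤y Q∣c+xw Q∣c+yw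
  ... | inj₂ y≤x = sym (congruence-unique-≤ cop x<Q y≤x Q∣c+yw Q∣c+xw)

  ∑<-congruence : ∀ {Q} .{{_ : NonZero Q}} {g w} c → Coprime w Q → g ∣ Q →
                  ∑[ x < Q ] ⟦ g ∣ x ⟧ * ⟦ Q ∣ c + x * w ⟧ ≡ ⟦ g ∣ c ⟧
  ∑<-congruence {Q} {g} {w} c cop g∣Q with x₀ , x₀<Q , Q∣c+x₀w ← congruence-solvable c cop = begin
    ∑[ x < Q ] ⟦ g ∣ x ⟧ * ⟦ Q ∣ c + x * w ⟧  ≡⟨ ∑<-point Q _ x₀<Q non-solution ⟩
    ⟦ g ∣ x₀ ⟧ * ⟦ Q ∣ c + x₀ * w ⟧         ≡⟨ cong (⟦ g ∣ x₀ ⟧ *_) (𝟙-yes (Q ∣? c + x₀ * w) Q∣c+x₀w) ⟩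
    ⟦ g ∣ x₀ ⟧ * 1                          ≡⟨ *-identityʳ _ ⟩
    ⟦ g ∣ x₀ ⟧                              ≡⟨ 𝟙-⇔ (g ∣? x₀) (g ∣? c) g∣x₀⇒g∣c g∣c⇒g∣x₀ ⟩
    ⟦ g ∣ c ⟧                               ∎
    where
    open ≡-Reasoning
    g∣c+x₀w : g ∣ c + x₀ * w
    g∣c+x₀w = ∣-trans g∣Q Q∣c+x₀w
    non-solution : ∀ x → x < Q → x ≢ x₀ → ⟦ g ∣ x ⟧ * ⟦ Q ∣ c + x * w ⟧ ≡ 0
    non-solution x x<Q x≢x₀ = trans
      (cong (⟦ g ∣ x ⟧ *_) (𝟙-no (Q ∣? c + x * w) (λ Q∣c+xw → x≢x₀ (congruence-unique cop x<Q x₀<Q Q∣c+xw Q∣c+x₀w))))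
      (*-zeroʳ ⟦ g ∣ x ⟧)
    g∣x₀⇒g∣c : g ∣ x₀ → g ∣ c
    g∣x₀⇒g∣c g∣x₀ = ∣m+n∣m⇒∣n (subst (g ∣_) (+-comm c (x₀ * w)) g∣c+x₀w) (∣m⇒∣m*n w g∣x₀)
    g∣c⇒g∣x₀ : g ∣ c → g ∣ x₀
    g∣c⇒g∣x₀ g∣c = coprime-divisor (Coprime.sym (λ (e∣w , e∣g) → cop (e∣w , ∣-trans e∣g g∣Q)))
                     (subst (g ∣_) (*-comm x₀ w) (∣m+n∣m⇒∣n g∣c+x₀w g∣c))

  length-exps-suc : ∀ k d → length (exps (suc k) d) ≡ ∑[ e < suc d ] length (exps k e)
  length-exps-suc k d = begin
    length (exps (suc k) d)                                              ≡⟨ length-concatMap (reverse (upTo (suc d))) _ ⟩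
    ∑[ e ∈ reverse (upTo (suc d)) ] length (map (e ∷_) (exps k (d ∸ e))) ≡⟨ ∑-reverse (upTo (suc d)) _ ⟩
    ∑[ e ∈ upTo (suc d) ] length (map (e ∷_) (exps k (d ∸ e)))           ≡⟨ ∑-cong (upTo (suc d)) (λ e → length-map {A = Vec ℕ k} (e ∷_) (exps k (d ∸ e))) ⟩
    ∑[ e ∈ upTo (suc d) ] length (exps k (d ∸ e))                        ≡⟨ ∑-applyUpTo id (suc d) _ ⟩
    ∑[ e < suc d ] length (exps k (d ∸ e))                               ≡⟨ ∑<-reverse d (λ e → length (exps k e)) ⟩
    ∑[ e < suc d ] length (exps k e)                                     ∎
    where open ≡-Reasoning

  ∑<-C : ∀ k d → ∑[ j < suc d ] (k + j) C j ≡ (suc k + d) C d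
  ∑<-C k zero = refl
  ∑<-C k (suc d) = begin
    ∑[ j < suc (suc d) ] (k + j) C j                  ≡⟨ ∑<-suc (suc d) (λ j → (k + j) C j) ⟩
    (∑[ j < suc d ] (k + j) C j) + (k + suc d) C suc d ≡⟨ cong₂ _+_ (∑<-C k d) (cong (_C suc d) (+-suc k d)) ⟩
    suc (k + d) C d + suc (k + d) C suc d             ≡⟨ nCk+nC[k+1]≡[n+1]C[k+1] (suc (k + d)) d ⟩
    suc (suc (k + d)) C suc d                         ≡⟨ cong (λ t → suc t C suc d) (+-suc k d) ⟨
    (suc k + suc d) C suc d                           ∎
    where open ≡-Reasoning

  length-exps : ∀ k d → length (exps (suc k) d) ≡ (k + d) C d
  length-exps zero d = begin
    length (exps 1 d)                      ≡⟨ length-exps-suc 0 d ⟩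
    1 + (∑[ e < d ] length (exps 0 (suc e))) ≡⟨ cong suc (∑<-zero d _ (λ _ _ → refl)) ⟩
    1                                      ≡⟨ nCn≡1 d ⟨
    d C d                                  ∎
    where open ≡-Reasoning
  length-exps (suc k) d = begin
    length (exps (2 + k) d)                   ≡⟨ length-exps-suc (suc k) d ⟩
    ∑[ e < suc d ] length (exps (suc k) e)    ≡⟨ ∑<-cong (suc d) (length-exps k) ⟩
    ∑[ e < suc d ] (k + e) C e                ≡⟨ ∑<-C k d ⟩
    (suc k + d) C d                           ∎
    where open ≡-Reasoning

  1≤C : ∀ k d → 1 ≤ (k + d) C d
  1≤C zero d = ≤-reflexive (sym (nCn≡1 d))
  1≤C (suc k) d = subst (1 ≤_) (∑<-C k d) (s≤s z≤n)

  2+n≤Ndn : ∀ d n → 2 ≤ d → 1 ≤ n → 2 + n ≤ Ndn d n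
  2+n≤Ndn (suc (suc d)) (suc n) (s≤s (s≤s z≤n)) (s≤s z≤n) =
    subst₂ _≤_ (cong suc (trans (+-assoc n 1 1) (+-comm n 2))) (∑<-C n (suc (suc d)))
      (+-mono-≤ (1≤C n 0) (+-mono-≤ (≤-reflexive (sym (nC1≡n (n + 1)))) (≤-trans (1≤C n 2) (m≤m+n _ _))))

  Any-exps : ∀ {k} {P : Vec ℕ (suc k) → Set} d {e} → e ≤ d →
             Any (λ es → P (e ∷ es)) (exps k (d ∸ e)) → Any P (exps (suc k) d)
  Any-exps d e≤d Pe∷es = concat⁺ (map⁺ (reverse⁺ (applyUpTo⁺ id (map⁺ Pe∷es) (s≤s e≤d))))

  monomial≡1 : ∀ {Q} k (b : Vec (Fin Q) k) → Any (λ es → monomial b es ≡ 1) (exps k 0)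
  monomial≡1 zero [] = here refl
  monomial≡1 (suc k) (x ∷ b) = Any-exps 0 z≤n (Any.map (λ {es} b^es≡1 → trans (+-identityʳ (monomial b es)) b^es≡1) (monomial≡1 k b))

  length-ν : ∀ {Q} d n (b : Vec (Fin Q) (suc n)) → length (ν d n b) ≡ Ndn d n
  length-ν d n b = trans (length-map (monomial b) (exps (suc n) d)) (length-exps n d)

  -- The witness is the pure power b_i ^ d of an entry with p ∤ b_i.
  ∤-monomial : ∀ {p Q} → Prime p → ∀ k (b : Vec (Fin Q) (suc k)) d → ⟦ p ∣* b ⟧ ≡ 0 →
               Any (λ es → ¬ p ∣ monomial b es) (exps (suc k) d)
  ∤-monomial {p} p-prime k (x ∷ b) d p∤*b with p ∣? toℕ x
  ... | no p∤x = Any-exps d ≤-refl (subst (λ t → Any (λ es → ¬ p ∣ monomial (x ∷ b) (d ∷ es)) (exps k t)) (sym (n∸n≡0 d))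
          (Any.map (λ {es} b^es≡1 p∣ → ∤⇒∤^ p-prime p∤x d (subst (p ∣_) (trans (cong (toℕ x ^ d *_) b^es≡1) (*-identityʳ _)) p∣))
                   (monomial≡1 k b)))
  ... | yes _ with k | b | trans (sym (+-identityʳ ⟦ p ∣* b ⟧)) p∤*b
  ...   | zero | [] | ()
  ...   | suc k | b | p∤*b′ = Any-exps d z≤n
          (Any.map (λ {es} p∤ p∣ → p∤ (subst (p ∣_) (+-identityʳ (monomial b es)) p∣)) (∤-monomial p-prime k b d p∤*b′))

  module Counting (Q g h : ℕ) .{{_ : NonZero Q}} .{{_ : NonZero g}} (Q≡h*g : Q ≡ h * g) where

    g∣Q : g ∣ Q
    g∣Q = divides h Q≡h*g

    ∑-⟦∣⟧ : ∑[ x ∈ allFin Q ] ⟦ g ∣ toℕ x ⟧ ≡ h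
    ∑-⟦∣⟧ = trans (∑-allFin Q (λ x → ⟦ g ∣ x ⟧)) (trans (cong (λ m → ∑[ x < m ] ⟦ g ∣ x ⟧) Q≡h*g) (∑<-multiples h g))

    ∑-⟦∣*⟧ : ∀ k → ∑[ a ∈ allVecs k Q ] ⟦ g ∣* a ⟧ ≡ h ^ k
    ∑-⟦∣*⟧ zero = refl
    ∑-⟦∣*⟧ (suc k) = begin
      ∑[ a ∈ allVecs (suc k) Q ] ⟦ g ∣* a ⟧                               ≡⟨ ∑-allVecs k Q _ ⟩
      ∑[ x ∈ allFin Q ] ∑[ a ∈ allVecs k Q ] ⟦ g ∣ toℕ x ⟧ * ⟦ g ∣* a ⟧     ≡⟨ ∑-cong (allFin Q) (λ x → ∑-*ˡ (allVecs k Q) ⟦ g ∣ toℕ x ⟧ _) ⟩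
      ∑[ x ∈ allFin Q ] ⟦ g ∣ toℕ x ⟧ * (∑[ a ∈ allVecs k Q ] ⟦ g ∣* a ⟧)   ≡⟨ ∑-*ʳ (allFin Q) _ _ ⟩
      (∑[ x ∈ allFin Q ] ⟦ g ∣ toℕ x ⟧) * (∑[ a ∈ allVecs k Q ] ⟦ g ∣* a ⟧) ≡⟨ cong₂ _*_ ∑-⟦∣⟧ (∑-⟦∣*⟧ k) ⟩
      h * h ^ k                                                          ∎
      where open ≡-Reasoning

    -- The number of a ∈ (gℤ/Qℤ)^k with c + ⟨a, v⟩ ≡ 0 (mod Q).
    #solutions : ∀ k → List ℕ → ℕ → ℕ
    #solutions k v c = ∑[ a ∈ allVecs k Q ] ⟦ g ∣* a ⟧ * ⟦ Q ∣ c + dot a v ⟧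

    #solutions-∷ : ∀ k w v c → #solutions (suc k) (w ∷ v) c ≡ ∑[ x ∈ allFin Q ] ⟦ g ∣ toℕ x ⟧ * #solutions k v (c + toℕ x * w)
    #solutions-∷ k w v c = trans (∑-allVecs k Q _) (∑-cong (allFin Q) λ x →
      trans (∑-cong (allVecs k Q) (λ a → trans (*-assoc ⟦ g ∣ toℕ x ⟧ ⟦ g ∣* a ⟧ _)
                                                (cong (λ t → ⟦ g ∣ toℕ x ⟧ * (⟦ g ∣* a ⟧ * ⟦ Q ∣ t ⟧)) (sym (+-assoc c _ _)))))
            (∑-*ˡ (allVecs k Q) ⟦ g ∣ toℕ x ⟧ _))

    -- Summing over the coprime coordinate first, each inner sum is a single congruence.
    #solutions-coprime-head : ∀ k w v c → Coprime w Q → #solutions (suc k) (w ∷ v) c ≡ ⟦ g ∣ c ⟧ * h ^ k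
    #solutions-coprime-head k w v c cop = begin
      #solutions (suc k) (w ∷ v) c                                          ≡⟨ #solutions-∷ k w v c ⟩
      ∑[ x ∈ allFin Q ] ⟦ g ∣ toℕ x ⟧ * #solutions k v (c + toℕ x * w)      ≡⟨ ∑-cong (allFin Q) (λ x → sym (∑-*ˡ (allVecs k Q) ⟦ g ∣ toℕ x ⟧ _)) ⟩
      ∑[ x ∈ allFin Q ] ∑[ a ∈ allVecs k Q ] F x a                          ≡⟨ ∑-swap (allFin Q) (allVecs k Q) F ⟩
      ∑[ a ∈ allVecs k Q ] ∑[ x ∈ allFin Q ] F x a                          ≡⟨ ∑-cong (allVecs k Q) inner ⟩
      ∑[ a ∈ allVecs k Q ] ⟦ g ∣* a ⟧ * ⟦ g ∣ c ⟧                           ≡⟨ ∑-*ʳ (allVecs k Q) ⟦ g ∣ c ⟧ _ ⟩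
      (∑[ a ∈ allVecs k Q ] ⟦ g ∣* a ⟧) * ⟦ g ∣ c ⟧                         ≡⟨ cong (_* ⟦ g ∣ c ⟧) (∑-⟦∣*⟧ k) ⟩
      h ^ k * ⟦ g ∣ c ⟧                                                    ≡⟨ *-comm (h ^ k) _ ⟩
      ⟦ g ∣ c ⟧ * h ^ k                                                    ∎
      where
      open ≡-Reasoning
      F : Fin Q → Vec (Fin Q) k → ℕ
      F x a = ⟦ g ∣ toℕ x ⟧ * (⟦ g ∣* a ⟧ * ⟦ Q ∣ (c + toℕ x * w) + dot a v ⟧)
      inner : ∀ a → ∑[ x ∈ allFin Q ] F x a ≡ ⟦ g ∣* a ⟧ * ⟦ g ∣ c ⟧
      inner a = begin
        ∑[ x ∈ allFin Q ] F x a
          ≡⟨ ∑-cong (allFin Q) (λ x → trans (*-left-comm ⟦ g ∣ toℕ x ⟧ ⟦ g ∣* a ⟧ _)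
               (cong (λ t → ⟦ g ∣* a ⟧ * (⟦ g ∣ toℕ x ⟧ * ⟦ Q ∣ t ⟧)) (+-right-comm c (toℕ x * w) (dot a v)))) ⟩
        ∑[ x ∈ allFin Q ] ⟦ g ∣* a ⟧ * (⟦ g ∣ toℕ x ⟧ * ⟦ Q ∣ (c + dot a v) + toℕ x * w ⟧)
          ≡⟨ ∑-*ˡ (allFin Q) ⟦ g ∣* a ⟧ _ ⟩
        ⟦ g ∣* a ⟧ * (∑[ x ∈ allFin Q ] ⟦ g ∣ toℕ x ⟧ * ⟦ Q ∣ (c + dot a v) + toℕ x * w ⟧)
          ≡⟨ cong (⟦ g ∣* a ⟧ *_) (trans (∑-allFin Q _) (∑<-congruence (c + dot a v) cop g∣Q)) ⟩
        ⟦ g ∣* a ⟧ * ⟦ g ∣ c + dot a v ⟧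
          ≡⟨ *⟦∣⟧-+ c (⟦∣*⟧≡0⊎∣dot g a v) ⟩
        ⟦ g ∣* a ⟧ * ⟦ g ∣ c ⟧
          ∎

    #solutions-tail : ∀ k w v c → (∀ c′ → #solutions (suc k) v c′ ≡ ⟦ g ∣ c′ ⟧ * h ^ k) →
                      #solutions (2 + k) (w ∷ v) c ≡ ⟦ g ∣ c ⟧ * h ^ suc k
    #solutions-tail k w v c #solutions≡ = begin
      #solutions (2 + k) (w ∷ v) c                                               ≡⟨ #solutions-∷ (suc k) w v c ⟩
      ∑[ x ∈ allFin Q ] ⟦ g ∣ toℕ x ⟧ * #solutions (suc k) v (c + toℕ x * w)     ≡⟨ ∑-cong (allFin Q) (λ x → cong (⟦ g ∣ toℕ x ⟧ *_) (#solutions≡ (c + toℕ x * w))) ⟩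
      ∑[ x ∈ allFin Q ] ⟦ g ∣ toℕ x ⟧ * (⟦ g ∣ c + toℕ x * w ⟧ * h ^ k)         ≡⟨ ∑-cong (allFin Q) shift ⟩
      ∑[ x ∈ allFin Q ] ⟦ g ∣ toℕ x ⟧ * (⟦ g ∣ c ⟧ * h ^ k)                     ≡⟨ ∑-*ʳ (allFin Q) _ _ ⟩
      (∑[ x ∈ allFin Q ] ⟦ g ∣ toℕ x ⟧) * (⟦ g ∣ c ⟧ * h ^ k)                   ≡⟨ cong (_* (⟦ g ∣ c ⟧ * h ^ k)) ∑-⟦∣⟧ ⟩
      h * (⟦ g ∣ c ⟧ * h ^ k)                                                  ≡⟨ *-left-comm h ⟦ g ∣ c ⟧ _ ⟩
      ⟦ g ∣ c ⟧ * (h * h ^ k)                                                  ∎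
      where
      open ≡-Reasoning
      shift : ∀ x → ⟦ g ∣ toℕ x ⟧ * (⟦ g ∣ c + toℕ x * w ⟧ * h ^ k) ≡ ⟦ g ∣ toℕ x ⟧ * (⟦ g ∣ c ⟧ * h ^ k)
      shift x = trans (sym (*-assoc ⟦ g ∣ toℕ x ⟧ _ (h ^ k)))
               (trans (cong (_* h ^ k) (*⟦∣⟧-+ c (⟦∣⟧≡0⊎∣* g (toℕ x) w))) (*-assoc ⟦ g ∣ toℕ x ⟧ _ (h ^ k)))

    #solutions≡ : ∀ k v c → length v ≡ suc k → Any (λ w → Coprime w Q) v → #solutions (suc k) v c ≡ ⟦ g ∣ c ⟧ * h ^ k
    #solutions≡ k (w ∷ v) c _ (here cop) = #solutions-coprime-head k w v c cop
    #solutions≡ (suc k) (w ∷ v) c len (there any) = #solutions-tail k w v c (λ c′ → #solutions≡ k v c′ (suc-injective len) any)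
    #solutions≡ zero (w ∷ []) c _ (there ())
    #solutions≡ zero (w ∷ _ ∷ _) c () (there _)

  ^-distribʳ-* : ∀ m n o → (m * n) ^ o ≡ m ^ o * n ^ o
  ^-distribʳ-* m n zero = refl
  ^-distribʳ-* m n (suc o) = trans (cong (m * n *_) (^-distribʳ-* m n o)) (interchange′ m n (m ^ o) (n ^ o))
    where
    interchange′ : ∀ a b c d → a * b * (c * d) ≡ a * c * (b * d)
    interchange′ = solve-∀

  x+s^k≡[p*s]^k⇒x≡s^k*[p^k∸1] : ∀ {x} p s k .{{_ : NonZero p}} → x + s ^ k ≡ (p * s) ^ k → x ≡ s ^ k * (p ^ k ∸ 1)
  x+s^k≡[p*s]^k⇒x≡s^k*[p^k∸1] {x} p s k eq = +-cancelʳ-≡ (s ^ k) x _ (begin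
    x + s ^ k                        ≡⟨ eq ⟩
    (p * s) ^ k                      ≡⟨ ^-distribʳ-* p s k ⟩
    p ^ k * s ^ k                    ≡⟨ *-comm (p ^ k) (s ^ k) ⟩
    s ^ k * p ^ k                    ≡⟨ cong (s ^ k *_) (m∸n+n≡m (m^n>0 p k)) ⟨
    s ^ k * (p ^ k ∸ 1 + 1)          ≡⟨ *-distribˡ-+ (s ^ k) (p ^ k ∸ 1) 1 ⟩
    s ^ k * (p ^ k ∸ 1) + s ^ k * 1  ≡⟨ cong (s ^ k * (p ^ k ∸ 1) +_) (*-identityʳ (s ^ k)) ⟩
    s ^ k * (p ^ k ∸ 1) + s ^ k      ∎)
    where open ≡-Reasoning

  -- δ = α + β + 1 − P, read off from (α + 1)(β + 1) = P (γ + 1).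
  product-defect : ∀ p P α β γ → α + 1 ≡ p * P → γ + 1 ≡ p * (β + 1) → α ≤ β → 2 ≤ p →
                   ∃[ δ ] α * β + δ ≡ P * γ × δ * (p * P) ≤ 4 * (P * γ)
  product-defect p P α β γ α+1≡pP γ+1≡p[β+1] α≤β 2≤p = α + β + 1 ∸ P , αβ+δ≡Pγ , δpP≤4Pγ
    where
    P≤α+β+1 : P ≤ α + β + 1
    P≤α+β+1 = begin
      P          ≤⟨ m≤n*m P p {{>-nonZero (<-trans z<s 2≤p)}} ⟩
      p * P      ≡⟨ α+1≡pP ⟨
      α + 1      ≤⟨ +-monoˡ-≤ 1 (m≤m+n α β) ⟩
      α + β + 1  ∎
      where open ≤-Reasoning
    Pγ+P≡αβ+[α+β+1] : P * γ + P ≡ α * β + (α + β + 1)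
    Pγ+P≡αβ+[α+β+1] = begin
      P * γ + P                ≡⟨ cong (P * γ +_) (*-identityʳ P) ⟨
      P * γ + P * 1            ≡⟨ *-distribˡ-+ P γ 1 ⟨
      P * (γ + 1)              ≡⟨ cong (P *_) γ+1≡p[β+1] ⟩
      P * (p * (β + 1))        ≡⟨ *-left-comm P p (β + 1) ⟩
      p * (P * (β + 1))        ≡⟨ *-assoc p P (β + 1) ⟨
      p * P * (β + 1)          ≡⟨ cong (_* (β + 1)) α+1≡pP ⟨
      (α + 1) * (β + 1)        ≡⟨ expand α β ⟩
      α * β + (α + β + 1)      ∎
      where
      open ≡-Reasoning
      expand : ∀ α β → (α + 1) * (β + 1) ≡ α * β + (α + β + 1)
      expand = solve-∀
    αβ+δ≡Pγ : α * β + (α + β + 1 ∸ P) ≡ P * γ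
    αβ+δ≡Pγ = +-cancelʳ-≡ P _ _ (begin
      α * β + (α + β + 1 ∸ P) + P  ≡⟨ +-assoc (α * β) _ P ⟩
      α * β + (α + β + 1 ∸ P + P)  ≡⟨ cong (α * β +_) (m∸n+n≡m P≤α+β+1) ⟩
      α * β + (α + β + 1)          ≡⟨ Pγ+P≡αβ+[α+β+1] ⟨
      P * γ + P                    ∎)
      where open ≡-Reasoning
    1≤γ : 1 ≤ γ
    1≤γ = +-cancelʳ-≤ 1 1 γ (begin
      2                ≤⟨ *-mono-≤ 2≤p (s≤s (z≤n {β})) ⟩
      p * suc β        ≡⟨ cong (p *_) (+-comm 1 β) ⟩
      p * (β + 1)      ≡⟨ γ+1≡p[β+1] ⟨
      γ + 1            ∎)
      where open ≤-Reasoning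
    δpP≤4Pγ : (α + β + 1 ∸ P) * (p * P) ≤ 4 * (P * γ)
    δpP≤4Pγ = begin
      (α + β + 1 ∸ P) * (p * P)  ≤⟨ *-monoˡ-≤ (p * P) (m∸n≤m (α + β + 1) P) ⟩
      (α + β + 1) * (p * P)      ≤⟨ *-monoˡ-≤ (p * P) (+-mono-≤ (+-monoˡ-≤ β α≤β) (n≤1+n 1)) ⟩
      (β + β + 2) * (p * P)      ≡⟨ regroup β p P ⟩
      2 * P * (p * (β + 1))      ≡⟨ cong (2 * P *_) γ+1≡p[β+1] ⟨
      2 * P * (γ + 1)            ≤⟨ *-monoʳ-≤ (2 * P) (+-monoʳ-≤ γ 1≤γ) ⟩
      2 * P * (γ + γ)            ≡⟨ double P γ ⟩
      4 * (P * γ)                ∎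
      where
      open ≤-Reasoning
      regroup : ∀ β p P → (β + β + 2) * (p * P) ≡ 2 * P * (p * (β + 1))
      regroup = solve-∀
      double : ∀ P γ → 2 * P * (γ + γ) ≡ 4 * (P * γ)
      double = solve-∀

  p^[1+k]∸1≢0 : ∀ {p} k → 1 < p → NonZero (p ^ suc k ∸ 1)
  p^[1+k]∸1≢0 {p} k 1<p = >-nonZero (∸-monoˡ-≤ 1 (≤-trans 1<p (m≤m*n p (p ^ k) {{m^n≢0 p k {{>-nonZero (<-trans z<s 1<p)}}}})))

  module AverageDefect (p s n N′ : ℕ) (1<p : 1 < p) .{{_ : NonZero s}} (n<N′ : n < N′) where

    private instance
      p≢0 : NonZero p
      p≢0 = >-nonZero (<-trans z<s 1<p)

    numerator denominator : ℕ
    numerator = s ^ N′ * (p ^ N′ ∸ 1) * (s ^ suc n * (p ^ suc n ∸ 1))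
    denominator = (p * s) ^ n * (s ^ suc N′ * (p ^ suc N′ ∸ 1))

    instance
      denominator≢0 : NonZero denominator
      denominator≢0 = m*n≢0 ((p * s) ^ n) _ {{m^n≢0 (p * s) n {{m*n≢0 p s}}}}
                            {{m*n≢0 (s ^ suc N′) _ {{m^n≢0 s (suc N′)}} {{p^[1+k]∸1≢0 N′ 1<p}}}}

    private
      P α β γ E : ℕ
      P = p ^ n
      α = p ^ suc n ∸ 1
      β = p ^ N′ ∸ 1
      γ = p ^ suc N′ ∸ 1
      E = s ^ N′ * s ^ suc n

      α+1≡pP : α + 1 ≡ p * P
      α+1≡pP = m∸n+n≡m (m^n>0 p (suc n))

      γ+1≡p[β+1] : γ + 1 ≡ p * (β + 1)
      γ+1≡p[β+1] = trans (m∸n+n≡m (m^n>0 p (suc N′))) (cong (p *_) (sym (m∸n+n≡m (m^n>0 p N′))))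

      α≤β : α ≤ β
      α≤β = ∸-monoˡ-≤ 1 (^-monoʳ-≤ p n<N′)

      numerator≡Eαβ : numerator ≡ E * (α * β)
      numerator≡Eαβ = regroup (s ^ N′) β (s ^ suc n) α
        where
        regroup : ∀ a β b α → a * β * (b * α) ≡ a * b * (α * β)
        regroup = solve-∀

      denominator≡EPγ : denominator ≡ E * (P * γ)
      denominator≡EPγ = begin
        (p * s) ^ n * (s ^ suc N′ * γ)    ≡⟨ cong (_* (s ^ suc N′ * γ)) (^-distribʳ-* p s n) ⟩
        P * s ^ n * (s ^ suc N′ * γ)      ≡⟨ regroup P (s ^ n) (s ^ suc N′) γ ⟩
        s ^ n * s ^ suc N′ * (P * γ)      ≡⟨ cong (_* (P * γ)) (^-distribˡ-+-* s n (suc N′)) ⟨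
        s ^ (n + suc N′) * (P * γ)        ≡⟨ cong (λ k → s ^ k * (P * γ)) exponents ⟩
        s ^ (N′ + suc n) * (P * γ)        ≡⟨ cong (_* (P * γ)) (^-distribˡ-+-* s N′ (suc n)) ⟩
        E * (P * γ)                       ∎
        where
        open ≡-Reasoning
        regroup : ∀ P a b γ → P * a * (b * γ) ≡ a * b * (P * γ)
        regroup = solve-∀
        exponents : n + suc N′ ≡ N′ + suc n
        exponents = trans (+-suc n N′) (trans (cong suc (+-comm n N′)) (sym (+-suc N′ n)))

    defect : ∃[ D ] numerator + D ≡ denominator × D * p ^ suc n ≤ 4 * denominator
    defect with δ , αβ+δ≡Pγ , δpP≤4Pγ ← product-defect p P α β γ α+1≡pP γ+1≡p[β+1] α≤β 1<p =
      E * δ , numerator+Eδ≡denominator , Eδp^[n+1]≤4denominator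
      where
      numerator+Eδ≡denominator : numerator + E * δ ≡ denominator
      numerator+Eδ≡denominator = begin
        numerator + E * δ        ≡⟨ cong (_+ E * δ) numerator≡Eαβ ⟩
        E * (α * β) + E * δ      ≡⟨ *-distribˡ-+ E (α * β) δ ⟨
        E * (α * β + δ)          ≡⟨ cong (E *_) αβ+δ≡Pγ ⟩
        E * (P * γ)              ≡⟨ denominator≡EPγ ⟨
        denominator              ∎
        where open ≡-Reasoning
      Eδp^[n+1]≤4denominator : E * δ * p ^ suc n ≤ 4 * denominator
      Eδp^[n+1]≤4denominator = begin
        E * δ * (p * P)      ≡⟨ *-assoc E δ (p * P) ⟩
        E * (δ * (p * P))    ≤⟨ *-monoʳ-≤ E δpP≤4Pγ ⟩
        E * (4 * (P * γ))    ≡⟨ *-left-comm E 4 (P * γ) ⟩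
        4 * (E * (P * γ))    ≡⟨ cong (4 *_) denominator≡EPγ ⟨
        4 * denominator      ∎
        where open ≤-Reasoning

  toℚᵘ-÷ℕ : ∀ m k → ℚ.toℚᵘ (m ÷ℕ suc k) ℚᵘ.≃ ℚᵘ.mkℚᵘ (ℤ.+ m) k
  toℚᵘ-÷ℕ m k = ℚᵘ.*≡* (begin
    ℚᵘ.↥ (ℚ.toℚᵘ r) ℤ.* ℤ.+ suc k        ≡⟨ cong (ℤ._* ℤ.+ suc k) (ℚP.↥ᵘ-toℚᵘ r) ⟩
    ℚ.↥ r ℤ.* ℤ.+ suc k                  ≡⟨ cong (ℚ.↥ r ℤ.*_) (ℚP.↧-/ (ℤ.+ m) (suc k)) ⟨
    ℚ.↥ r ℤ.* (ℚ.↧ r ℤ.* g)              ≡⟨ rearrange (ℚ.↥ r) (ℚ.↧ r) g ⟩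
    ℚ.↥ r ℤ.* g ℤ.* ℚ.↧ r                ≡⟨ cong₂ ℤ._*_ (ℚP.↥-/ (ℤ.+ m) (suc k)) (sym (ℚP.↧ᵘ-toℚᵘ r)) ⟩
    ℤ.+ m ℤ.* ℚᵘ.↧ (ℚ.toℚᵘ r)            ∎)
    where
    open ≡-Reasoning
    r = (ℤ.+ m) ℚ./ suc k
    g = ℤ-gcd (ℤ.+ m) (ℤ.+ suc k)
    rearrange : ∀ a b c → a ℤ.* (b ℤ.* c) ≡ a ℤ.* c ℤ.* b
    rearrange = ℤ-solve-∀

  sumℚ-÷ℕ : ∀ (xs : List A) (f : A → ℕ) {w} .{{_ : NonZero w}} → sumℚ (map (λ x → f x ÷ℕ w) xs) ≡ ∑ xs f ÷ℕ w
  sumℚ-÷ℕ xs f {suc k} = ℚP.toℚᵘ-injective (ℚᵘP.≃-trans (toℚᵘ-sumℚ xs) (ℚᵘP.≃-sym (toℚᵘ-÷ℕ (∑ xs f) k)))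
    where
    common-denominator : ∀ a b K → (a ℤ.* K ℤ.+ b ℤ.* K) ℤ.* K ≡ (a ℤ.+ b) ℤ.* (K ℤ.* K)
    common-denominator = ℤ-solve-∀
    toℚᵘ-sumℚ : ∀ xs → ℚ.toℚᵘ (sumℚ (map (λ x → f x ÷ℕ suc k) xs)) ℚᵘ.≃ ℚᵘ.mkℚᵘ (ℤ.+ ∑ xs f) k
    toℚᵘ-sumℚ [] = ℚᵘ.*≡* refl
    toℚᵘ-sumℚ (x ∷ xs) = ℚᵘP.≃-trans (ℚP.toℚᵘ-homo-+ (f x ÷ℕ suc k) _)
      (ℚᵘP.≃-trans (ℚᵘP.+-cong (toℚᵘ-÷ℕ (f x) k) (toℚᵘ-sumℚ xs))
        (ℚᵘ.*≡* (trans (common-denominator (ℤ.+ f x) (ℤ.+ ∑ xs f) (ℤ.+ suc k))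
                       (cong₂ ℤ._*_ (sym (ℤP.pos-+ (f x) _)) (sym (ℤP.pos-* (suc k) (suc k)))))))

  ÷ℕ-*-1÷ℕ : ∀ m {a b} .{{_ : NonZero a}} .{{_ : NonZero b}} → (m ÷ℕ a) ℚ.* (1 ÷ℕ b) ≡ m ÷ℕ (a * b)
  ÷ℕ-*-1÷ℕ m {suc a} {suc b} = ℚP.toℚᵘ-injective
    (ℚᵘP.≃-trans (ℚP.toℚᵘ-homo-* (m ÷ℕ suc a) (1 ÷ℕ suc b))
    (ℚᵘP.≃-trans (ℚᵘP.*-cong (toℚᵘ-÷ℕ m a) (toℚᵘ-÷ℕ 1 b))
    (ℚᵘP.≃-trans (ℚᵘ.*≡* (cong (ℤ._* ℤ.+ suc (b + a * suc b)) (ℤP.*-identityʳ (ℤ.+ m))))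
                 (ℚᵘP.≃-sym (toℚᵘ-÷ℕ m (b + a * suc b))))))

  -- |u/w − 1| = D/w, and D/w ≤ c/m is the cross-multiplied hypothesis.
  ∣u÷ℕw-1∣≤ : ∀ {u D w m} c .{{_ : NonZero w}} .{{_ : NonZero m}} → u + D ≡ w → D * m ≤ c * w →
              ℚ.∣ u ÷ℕ w ℚ.- ℚ.1ℚ ∣ ℚ.≤ (c ÷ℕ 1) ℚ.* (1 ÷ℕ m)
  ∣u÷ℕw-1∣≤ {u} {D} {suc w} {suc m} c u+D≡w Dm≤cw =
    ℚP.toℚᵘ-cancel-≤ (ℚᵘP.≤-respˡ-≃ (ℚᵘP.≃-sym lhs) (ℚᵘP.≤-respʳ-≃ (ℚᵘP.≃-sym rhs) D÷w≤c÷m))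
    where
    W = ℤ.+ suc w
    difference : ∀ U D → (U ℤ.* ℤ.+ 1 ℤ.+ ℤ.-[1+ 0 ] ℤ.* (U ℤ.+ D)) ℤ.* (U ℤ.+ D) ≡ ℤ.- D ℤ.* ((U ℤ.+ D) ℤ.* ℤ.+ 1)
    difference = ℤ-solve-∀
    u-w≃-D : ℚᵘ.mkℚᵘ (ℤ.+ u) w ℚᵘ.+ ℚᵘ.mkℚᵘ ℤ.-[1+ 0 ] 0 ℚᵘ.≃ ℚᵘ.mkℚᵘ (ℤ.- ℤ.+ D) w
    u-w≃-D = ℚᵘ.*≡* (trans (subst (λ V → (ℤ.+ u ℤ.* ℤ.+ 1 ℤ.+ ℤ.-[1+ 0 ] ℤ.* V) ℤ.* V ≡ ℤ.- ℤ.+ D ℤ.* (V ℤ.* ℤ.+ 1))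
                                    (trans (sym (ℤP.pos-+ u D)) (cong ℤ.+_ u+D≡w)) (difference (ℤ.+ u) (ℤ.+ D)))
                             (cong (ℤ.- ℤ.+ D ℤ.*_) (sym (ℤP.pos-* (suc w) 1))))
    lhs : ℚ.toℚᵘ ℚ.∣ u ÷ℕ suc w ℚ.- ℚ.1ℚ ∣ ℚᵘ.≃ ℚᵘ.mkℚᵘ (ℤ.+ D) w
    lhs = ℚᵘP.≃-trans (ℚP.toℚᵘ-homo-∣-∣ (u ÷ℕ suc w ℚ.- ℚ.1ℚ))
         (ℚᵘP.≃-trans (ℚᵘP.∣-∣-cong (ℚᵘP.≃-trans (ℚP.toℚᵘ-homo-+ (u ÷ℕ suc w) (ℚ.- ℚ.1ℚ))
                                                 (ℚᵘP.+-cong (toℚᵘ-÷ℕ u w) (ℚP.toℚᵘ-homo‿- ℚ.1ℚ))))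
         (ℚᵘP.≃-trans (ℚᵘP.∣-∣-cong u-w≃-D)
                      (ℚᵘP.≃-reflexive (cong (λ t → ℚᵘ.mkℚᵘ (ℤ.+ t) w) (ℤP.∣-i∣≡∣i∣ (ℤ.+ D))))))
    rhs : ℚ.toℚᵘ ((c ÷ℕ 1) ℚ.* (1 ÷ℕ suc m)) ℚᵘ.≃ ℚᵘ.mkℚᵘ (ℤ.+ c) m
    rhs = ℚᵘP.≃-trans (ℚP.toℚᵘ-homo-* (c ÷ℕ 1) (1 ÷ℕ suc m))
         (ℚᵘP.≃-trans (ℚᵘP.*-cong (toℚᵘ-÷ℕ c 0) (toℚᵘ-÷ℕ 1 m))
                      (ℚᵘ.*≡* (cong₂ ℤ._*_ (ℤP.*-identityʳ (ℤ.+ c)) (cong ℤ.+_ (sym (cong suc (+-identityʳ m)))))))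
    D÷w≤c÷m : ℚᵘ.mkℚᵘ (ℤ.+ D) w ℚᵘ.≤ ℚᵘ.mkℚᵘ (ℤ.+ c) m
    D÷w≤c÷m = ℚᵘ.*≤* (subst₂ ℤ._≤_ (ℤP.pos-* D (suc m)) (ℤP.pos-* c (suc w)) (ℤ.+≤+ Dm≤cw))

  module PrimePower (p r : ℕ) (p-prime : Prime p) where

    s Q : ℕ
    s = p ^ r
    Q = p ^ suc r

    instance
      p≢0 : NonZero p
      p≢0 = prime⇒nonZero p-prime
      s≢0 : NonZero s
      s≢0 = m^n≢0 p r
      Q≢0 : NonZero Q
      Q≢0 = m^n≢0 p (suc r)

    1<p : 1 < p
    1<p = nonTrivial⇒n>1 p {{prime⇒nonTrivial p-prime}}

    module Unrestricted = Counting Q 1 Q (sym (*-identityʳ Q))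
    module Divisible = Counting Q p s (*-comm p s)

    𝟙-primitive : ∀ {k} → Vec (Fin Q) k → ℕ
    𝟙-primitive a = 𝟙 (gcdAll Q a ≟ 1)

    private
      -- The invariant of the fold computing gcd(Q, a₁, …, a_k), with g the running gcd.
      gcdAll-≟1 : ∀ {k g} (a : Vec (Fin Q) k) → g ∣ Q → 𝟙 (gcdAll g a ≟ 1) + ⟦ p ∣ g ⟧ * ⟦ p ∣* a ⟧ ≡ 1
      gcdAll-≟1 {g = g} [] g∣Q with p ∣? g
      ... | yes p∣g = cong (_+ 1) (𝟙-no (g ≟ 1) (λ { refl → prime∤1 p-prime p∣g }))
      ... | no p∤g = cong (_+ 0) (𝟙-yes (g ≟ 1) (∣^∧∤⇒≡1 p-prime (suc r) g∣Q p∤g))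
      gcdAll-≟1 {g = g} (x ∷ a) g∣Q = begin
        𝟙 (gcdAll g′ a ≟ 1) + ⟦ p ∣ g ⟧ * (⟦ p ∣ toℕ x ⟧ * ⟦ p ∣* a ⟧)
          ≡⟨ cong (𝟙 (gcdAll g′ a ≟ 1) +_) (*-assoc ⟦ p ∣ g ⟧ _ _) ⟨
        𝟙 (gcdAll g′ a ≟ 1) + ⟦ p ∣ g ⟧ * ⟦ p ∣ toℕ x ⟧ * ⟦ p ∣* a ⟧
          ≡⟨ cong (λ t → 𝟙 (gcdAll g′ a ≟ 1) + t * ⟦ p ∣* a ⟧)
                  (𝟙-× (p ∣? g) (p ∣? toℕ x) (p ∣? g′) p∣gcd⇒ gcd-greatest) ⟨
        𝟙 (gcdAll g′ a ≟ 1) + ⟦ p ∣ g′ ⟧ * ⟦ p ∣* a ⟧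
          ≡⟨ gcdAll-≟1 a (∣-trans (gcd[m,n]∣m g (toℕ x)) g∣Q) ⟩
        1 ∎
        where
        open ≡-Reasoning
        g′ = gcd g (toℕ x)
        p∣gcd⇒ : p ∣ g′ → p ∣ g × p ∣ toℕ x
        p∣gcd⇒ p∣g′ = ∣-trans p∣g′ (gcd[m,n]∣m g (toℕ x)) , ∣-trans p∣g′ (gcd[m,n]∣n g (toℕ x))

    𝟙-primitive+⟦p∣*⟧ : ∀ {k} (a : Vec (Fin Q) k) → 𝟙-primitive a + ⟦ p ∣* a ⟧ ≡ ⟦ 1 ∣* a ⟧
    𝟙-primitive+⟦p∣*⟧ a = begin
      𝟙-primitive a + ⟦ p ∣* a ⟧              ≡⟨ cong (𝟙-primitive a +_) (*-identityˡ _) ⟨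
      𝟙-primitive a + 1 * ⟦ p ∣* a ⟧          ≡⟨ cong (λ t → 𝟙-primitive a + t * ⟦ p ∣* a ⟧) (𝟙-yes (p ∣? Q) (m∣m*n s)) ⟨
      𝟙-primitive a + ⟦ p ∣ Q ⟧ * ⟦ p ∣* a ⟧  ≡⟨ gcdAll-≟1 a ∣-refl ⟩
      1                                       ≡⟨ ⟦1∣*⟧≡1 a ⟨
      ⟦ 1 ∣* a ⟧                              ∎
      where open ≡-Reasoning

    #primitive : ∀ k → length (primVecs k Q) ≡ s ^ k * (p ^ k ∸ 1)
    #primitive k = x+s^k≡[p*s]^k⇒x≡s^k*[p^k∸1] p s k (begin
      length (primVecs k Q) + s ^ k
        ≡⟨ cong₂ _+_ (length-filter (λ a → gcdAll Q a ≟ 1) (allVecs k Q)) (sym (Divisible.∑-⟦∣*⟧ k)) ⟩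
      (∑[ a ∈ allVecs k Q ] 𝟙-primitive a) + (∑[ a ∈ allVecs k Q ] ⟦ p ∣* a ⟧)
        ≡⟨ ∑-+ (allVecs k Q) 𝟙-primitive ⟦ p ∣*_⟧ ⟨
      ∑[ a ∈ allVecs k Q ] (𝟙-primitive a + ⟦ p ∣* a ⟧)
        ≡⟨ ∑-cong (allVecs k Q) 𝟙-primitive+⟦p∣*⟧ ⟩
      ∑[ a ∈ allVecs k Q ] ⟦ 1 ∣* a ⟧
        ≡⟨ Unrestricted.∑-⟦∣*⟧ k ⟩
      Q ^ k ∎)
      where open ≡-Reasoning

    #primitive-solutions : ∀ {N k} → N ≡ suc k → ∀ v → length v ≡ N → Any (λ w → Coprime w Q) v →
                           ∑[ a ∈ primVecs N Q ] ⟦ Q ∣ dot a v ⟧ ≡ s ^ k * (p ^ k ∸ 1)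
    #primitive-solutions {k = k} refl v length≡ coprime = x+s^k≡[p*s]^k⇒x≡s^k*[p^k∸1] p s k (begin
      (∑[ a ∈ primVecs (suc k) Q ] ⟦ Q ∣ dot a v ⟧) + s ^ k
        ≡⟨ cong₂ _+_ (∑-filter (λ a → gcdAll Q a ≟ 1) (allVecs (suc k) Q) _) (sym divisible) ⟩
      (∑[ a ∈ allVecs (suc k) Q ] 𝟙-primitive a * ⟦ Q ∣ dot a v ⟧) + Divisible.#solutions (suc k) v 0
        ≡⟨ ∑-+ (allVecs (suc k) Q) _ _ ⟨
      ∑[ a ∈ allVecs (suc k) Q ] (𝟙-primitive a * ⟦ Q ∣ dot a v ⟧ + ⟦ p ∣* a ⟧ * ⟦ Q ∣ dot a v ⟧)
        ≡⟨ ∑-cong (allVecs (suc k) Q) (λ a → trans (sym (*-distribʳ-+ _ (𝟙-primitive a) _))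
                                                    (cong (_* ⟦ Q ∣ dot a v ⟧) (𝟙-primitive+⟦p∣*⟧ a))) ⟩
      Unrestricted.#solutions (suc k) v 0
        ≡⟨ Unrestricted.#solutions≡ k v 0 length≡ coprime ⟩
      ⟦ 1 ∣ 0 ⟧ * Q ^ k
        ≡⟨ +-identityʳ (Q ^ k) ⟩
      Q ^ k ∎)
      where
      open ≡-Reasoning
      divisible : Divisible.#solutions (suc k) v 0 ≡ s ^ k
      divisible = trans (Divisible.#solutions≡ k v 0 length≡ coprime)
                        (trans (cong (_* s ^ k) (𝟙-yes (p ∣? 0) (p ∣0))) (*-identityˡ (s ^ k)))

    ν-coprime : ∀ d n (b : Vec (Fin Q) (suc n)) → gcdAll Q b ≡ 1 → Any (λ w → Coprime w Q) (ν d n b)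
    ν-coprime d n b gcd≡1 = map⁺ (Any.map (∤⇒coprime-^ p-prime (suc r)) (∤-monomial p-prime n b d p∤*b))
      where
      p∤*b : ⟦ p ∣* b ⟧ ≡ 0
      p∤*b = suc-injective (begin
        1 + ⟦ p ∣* b ⟧             ≡⟨ cong (_+ ⟦ p ∣* b ⟧) (𝟙-yes (gcdAll Q b ≟ 1) gcd≡1) ⟨
        𝟙-primitive b + ⟦ p ∣* b ⟧ ≡⟨ 𝟙-primitive+⟦p∣*⟧ b ⟩
        ⟦ 1 ∣* b ⟧                 ≡⟨ ⟦1∣*⟧≡1 b ⟩
        1                          ∎)
        where open ≡-Reasoning

    -- Exchanging the order of summation: every primitive b contributes the same number of a.
    ∑-#σ-numerators : ∀ d n {N′} → Ndn d n ≡ suc N′ →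
      ∑[ a ∈ primVecs (Ndn d n) Q ] length (filter (λ b → Q ∣? pairing d n a b) (primVecs (suc n) Q))
        ≡ s ^ N′ * (p ^ N′ ∸ 1) * length (primVecs (suc n) Q)
    ∑-#σ-numerators d n {N′} N≡1+N′ = begin
      ∑[ a ∈ PN ] length (filter (λ b → Q ∣? pairing d n a b) PM)
        ≡⟨ ∑-cong PN (λ a → length-filter (λ b → Q ∣? pairing d n a b) PM) ⟩
      ∑[ a ∈ PN ] ∑[ b ∈ PM ] ⟦ Q ∣ pairing d n a b ⟧
        ≡⟨ ∑-swap PN PM (λ a b → ⟦ Q ∣ pairing d n a b ⟧) ⟩
      ∑[ b ∈ PM ] ∑[ a ∈ PN ] ⟦ Q ∣ pairing d n a b ⟧
        ≡⟨ ∑-filter-cong (λ b → gcdAll Q b ≟ 1) (allVecs (suc n) Q) (λ b gcd≡1 →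
             #primitive-solutions N≡1+N′ (ν d n b) (length-ν d n b) (ν-coprime d n b gcd≡1)) ⟩
      ∑[ b ∈ PM ] s ^ N′ * (p ^ N′ ∸ 1)
        ≡⟨ ∑-const PM _ ⟩
      s ^ N′ * (p ^ N′ ∸ 1) * length PM ∎
      where
      open ≡-Reasoning
      PN = primVecs (Ndn d n) Q
      PM = primVecs (suc n) Q

    avgσ≡ : ∀ d n {N′} → Ndn d n ≡ suc N′ →
            avgσ d n Q ≡ (s ^ N′ * (p ^ N′ ∸ 1) * (s ^ suc n * (p ^ suc n ∸ 1))) ÷ℕ (Q ^ n * (s ^ suc N′ * (p ^ suc N′ ∸ 1)))
    avgσ≡ d n {N′} N≡1+N′ = begin
      avgσ d n Q
        ≡⟨ cong (ℚ._* (1 ÷ℕ length PN)) (sumℚ-÷ℕ PN #σ-numerator {{m^n≢0 Q n}}) ⟩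
      (∑ PN #σ-numerator ÷ℕ (Q ^ n)) ℚ.* (1 ÷ℕ length PN)
        ≡⟨ cong₂ (λ a b → (a ÷ℕ (Q ^ n)) ℚ.* (1 ÷ℕ b))
                 (trans (∑-#σ-numerators d n N≡1+N′) (cong (s ^ N′ * (p ^ N′ ∸ 1) *_) (#primitive (suc n))))
                 (trans (#primitive (Ndn d n)) (cong (λ k → s ^ k * (p ^ k ∸ 1)) N≡1+N′)) ⟩
      ((s ^ N′ * (p ^ N′ ∸ 1) * (s ^ suc n * (p ^ suc n ∸ 1))) ÷ℕ (Q ^ n)) ℚ.* (1 ÷ℕ (s ^ suc N′ * (p ^ suc N′ ∸ 1)))
        ≡⟨ ÷ℕ-*-1÷ℕ _ {{m^n≢0 Q n}} {{m*n≢0 (s ^ suc N′) _ {{m^n≢0 s (suc N′)}} {{p^[1+k]∸1≢0 N′ 1<p}}}} ⟩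
      (s ^ N′ * (p ^ N′ ∸ 1) * (s ^ suc n * (p ^ suc n ∸ 1))) ÷ℕ (Q ^ n * (s ^ suc N′ * (p ^ suc N′ ∸ 1))) ∎
      where
      open ≡-Reasoning
      PN = primVecs (Ndn d n) Q
      #σ-numerator : Vec (Fin Q) (Ndn d n) → ℕ
      #σ-numerator a = length (filter (λ b → Q ∣? pairing d n a b) (primVecs (suc n) Q))

  avgσ-bound : ∀ d n p r → 2 ≤ d → 1 ≤ n → Prime p →
               ℚ.∣ avgσ d n (p ^ suc r) ℚ.- ℚ.1ℚ ∣ ℚ.≤ (4 ÷ℕ 1) ℚ.* (1 ÷ℕ (p ^ suc n))
  avgσ-bound d n p r 2≤d 1≤n p-prime =
    let _ , numerator+D≡denominator , Dp^[n+1]≤4denominator = defect in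
    subst (λ t → ℚ.∣ t ℚ.- ℚ.1ℚ ∣ ℚ.≤ (4 ÷ℕ 1) ℚ.* (1 ÷ℕ (p ^ suc n))) (sym (avgσ≡ d n N≡1+N′))
          (∣u÷ℕw-1∣≤ 4 numerator+D≡denominator Dp^[n+1]≤4denominator)
    where
    open PrimePower p r p-prime
    instance
      p^[1+n]≢0 : NonZero (p ^ suc n)
      p^[1+n]≢0 = m^n≢0 p (suc n)
    2+n≤N : 2 + n ≤ Ndn d n
    2+n≤N = 2+n≤Ndn d n 2≤d 1≤n
    N′ : ℕ
    N′ = pred (Ndn d n)
    N≡1+N′ : Ndn d n ≡ suc N′
    N≡1+N′ = sym (suc-pred (Ndn d n) {{>-nonZero (≤-trans (s≤s z≤n) 2+n≤N)}})
    open AverageDefect p s n N′ 1<p (s≤s⁻¹ (subst (2 + n ≤_) N≡1+N′ 2+n≤N))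


open AverageOverPrimePowers using (avgσ-bound)
open import Data.Rational using (ℚ; 1ℚ; ∣_∣; _-_; _*_) renaming (_≤_ to _≤ℚ_)

lemma5p4 : ∀ (d n : ℕ) → 2 ≤ d → 3 ≤ n → ∃[ C ] (∀ (p r : ℕ) → Prime p → 1 ≤ r → ∣ avgσ d n (p ^ r) - 1ℚ ∣ ≤ℚ C * (1 ÷ℕ (p ^ suc n)))
lemma5p4 d n 2≤d 3≤n = 4 ÷ℕ 1 , λ where
  p zero _ ()
  p (suc r) p-prime _ → avgσ-bound d n p r 2≤d (≤-trans (s≤s z≤n) 3≤n) p-prime
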